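{- Let $\mathbf u=(u_1,\dots,u_r)\in\mathbb{N}_{>0}^r$ and $\mathcal M(\mathbf u)=\{M\in M_r(\mathbb{N}): M\mathbf u\le\mathbf u\}$. Then $\#\mathcal M(\mathbf u)=\prod_{i=1}^r\#\{\alpha\in\mathbb{N}^r:\alpha\cdot\mathbf u\le u_i\}$, and the number of binary operations on $E_{\mathbf u}$ satisfying (S1) and (S2) is $\#\mathcal M(\mathbf u)^{|E_{\mathbf u}|-1}$, where $|E_{\mathbf u}|=\prod_{i=1}^r(u_i+1)$.
   Context: $\mathbb{N}$ includes $0$. For $\mathbf u\in\mathbb{N}_{>0}^r$, $E_{\mathbf u}=\{x\in\mathbb{Z}_{\ge0}^r:0\le x\le\mathbf u\}$ is the effect algebra with partial addition $x\oplus y=x+y$ defined (written $x\perp y$) iff $x+y\le\mathbf u$, top $\mathbf u$. Axioms for a total binary operation $\circ$: (S1) $b\perp c\Rightarrow a\circ(b\oplus c)=(a\circ b)\oplus(a\circ c)$; (S2) $\mathbf u\circ a=a$. -}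

module Defs where

open import Level using (0ℓ)
open import Data.Nat using (ℕ; zero; suc; _+_; _*_; _≤_)
open import Data.Fin using (Fin; zero; suc)
open import Data.Product using (Σ; _×_; _,_; proj₁)
open import Relation.Binary.Bundles using (Setoid)
open import Relation.Binary.PropositionalEquality as ≡ using (_≡_)
open import Function.Bundles using (Inverse)

∑ : ∀ {r} → (Fin r → ℕ) → ℕ
∑ {zero}  f = 0
∑ {suc r} f = f zero + ∑ (λ i → f (suc i))

∏ : ∀ {r} → (Fin r → ℕ) → ℕ
∏ {zero}  f = 1
∏ {suc r} f = f zero * ∏ (λ i → f (suc i))

Vecℕ : ℕ → Set
Vecℕ r = Fin r → ℕ

_≤ᵥ_ : ∀ {r} → Vecℕ r → Vecℕ r → Set
x ≤ᵥ y = ∀ i → x i ≤ y i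

_≗ᵥ_ : ∀ {r} → Vecℕ r → Vecℕ r → Set
x ≗ᵥ y = ∀ i → x i ≡ y i

_·_ : ∀ {r} → Vecℕ r → Vecℕ r → ℕ
α · u = ∑ (λ j → α j * u j)

Matℕ : ℕ → Set
Matℕ r = Fin r → Fin r → ℕ

_⊛_ : ∀ {r} → Matℕ r → Vecℕ r → Vecℕ r
(M ⊛ u) i = M i · u

HasCard : Setoid 0ℓ 0ℓ → ℕ → Set
HasCard S n = Inverse S (≡.setoid (Fin n))

E : ∀ {r} → Vecℕ r → Set
E {r} u = Σ (Vecℕ r) (λ x → x ≤ᵥ u)

val : ∀ {r} {u : Vecℕ r} → E u → Vecℕ r
val = proj₁

_≈E_ : ∀ {r} {u : Vecℕ r} → E u → E u → Set
x ≈E y = val x ≗ᵥ val y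

E-setoid : ∀ {r} → Vecℕ r → Setoid 0ℓ 0ℓ
E-setoid u = record
  { Carrier = E u
  ; _≈_ = _≈E_
  ; isEquivalence = record
    { refl = λ i → ≡.refl
    ; sym = λ p i → ≡.sym (p i)
    ; trans = λ p q i → ≡.trans (p i) (q i) } }

_⊥[_]_ : ∀ {r} → Vecℕ r → Vecℕ r → Vecℕ r → Set
x ⊥[ u ] y = (λ i → x i + y i) ≤ᵥ u

⊕ : ∀ {r} (u : Vecℕ r) (x y : E u) → val x ⊥[ u ] val y → E u
⊕ u x y h = (λ i → val x i + val y i) , h

top : ∀ {r} (u : Vecℕ r) → E u
top u = u , λ i → Data.Nat.Properties.≤-refl
  where import Data.Nat.Properties

IsOp : ∀ {r} (u : Vecℕ r) → (E u → E u → E u) → Set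
IsOp u o = ∀ {a a' b b'} → a ≈E a' → b ≈E b' → o a b ≈E o a' b'

-- (S1): b ⊥ c ⇒ a∘(b⊕c) = (a∘b) ⊕ (a∘c)   (in particular (a∘b) ⊥ (a∘c))
S1 : ∀ {r} (u : Vecℕ r) → (E u → E u → E u) → Set
S1 u o = ∀ a b c (h : val b ⊥[ u ] val c) →
  Σ (val (o a b) ⊥[ u ] val (o a c)) λ h' →
    o a (⊕ u b c h) ≈E ⊕ u (o a b) (o a c) h'

S2 : ∀ {r} (u : Vecℕ r) → (E u → E u → E u) → Set
S2 u o = ∀ a → o (top u) a ≈E a

Ops-setoid : ∀ {r} → Vecℕ r → Setoid 0ℓ 0ℓ
Ops-setoid u = record
  { Carrier = Σ (E u → E u → E u) (λ o → IsOp u o × S1 u o × S2 u o)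
  ; _≈_ = λ o o' → ∀ a b → proj₁ o a b ≈E proj₁ o' a b
  ; isEquivalence = record
    { refl = λ a b i → ≡.refl
    ; sym = λ p a b i → ≡.sym (p a b i)
    ; trans = λ p q a b i → ≡.trans (p a b i) (q a b i) } }

𝓜-setoid : ∀ {r} → Vecℕ r → Setoid 0ℓ 0ℓ
𝓜-setoid {r} u = record
  { Carrier = Σ (Matℕ r) (λ M → (M ⊛ u) ≤ᵥ u)
  ; _≈_ = λ M M' → ∀ i j → proj₁ M i j ≡ proj₁ M' i j
  ; isEquivalence = record
    { refl = λ i j → ≡.refl
    ; sym = λ p i j → ≡.sym (p i j)
    ; trans = λ p q i j → ≡.trans (p i j) (q i j) } }

Α-setoid : ∀ {r} → Vecℕ r → Fin r → Setoid 0ℓ 0ℓ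
Α-setoid {r} u i = record
  { Carrier = Σ (Vecℕ r) (λ α → α · u ≤ u i)
  ; _≈_ = λ α β → proj₁ α ≗ᵥ proj₁ β
  ; isEquivalence = record
    { refl = λ j → ≡.refl
    ; sym = λ p j → ≡.sym (p j)
    ; trans = λ p q j → ≡.trans (p j) (q j) } }

-- By (S1), for fixed a the map x ↦ a ∘ x is additive on E_u. Every x ∈ E_u is a
-- sum of unit vectors e_j, which lie in E_u because u is positive, so this map is
-- the matrix M_a whose columns are the a ∘ e_j, and M_a u = a ∘ u ≤ u puts M_a in
-- 𝓜(u); conversely every M ∈ 𝓜(u) acts additively on E_u. (S2) forces M_u = I and
-- leaves the other |E_u| − 1 matrices free. Finally M u ≤ u is a condition on each
-- row separately, so 𝓜(u) is the product of the sets {α : α·u ≤ u_i}; these are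
-- finite since α ≤ u_i entrywise.
module Submission where

open import Defs
open import Data.Nat using (ℕ; suc; _<_; _∸_; _^_)
open import Data.Fin using (Fin)
open import Data.Product using (Σ; _×_)

open import Level using (0ℓ)
open import Data.Nat using (zero; _+_; _*_; _≤_; z≤n; s≤s; s≤s⁻¹; _≤?_; >-nonZero)
open import Data.Nat.Properties
  using (+-mono-≤; *-monoʳ-≤; ≤-trans; ≤-reflexive; m≤m+n; m≤n+m; m≤m*n; n≤0⇒n≡0;
         m∸n≤m; m∸n+n≡m; +-comm; +-identityʳ; +-cancelˡ-≡; *-comm; *-identityʳ; *-identityˡ;
         *-zeroʳ; *-distribˡ-+; +-commutativeSemigroup)
import Data.Nat.Properties as ℕ
open import Algebra.Properties.CommutativeSemigroup +-commutativeSemigroup using (interchange)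
open import Data.Fin using (zero; suc; toℕ; fromℕ<; punchIn)
open import Data.Fin.Properties using (suc-injective; toℕ-injective; toℕ<n; toℕ-fromℕ<; fromℕ<-toℕ; *↔×)
open import Data.Vec.Functional using (insertAt; removeAt)
open import Data.Vec.Functional.Properties using (insertAt-lookup; insertAt-punchIn; insertAt-removeAt)
open import Data.Product using (_,_; proj₁; proj₂; ∃; ∃₂; map; map₂)
open import Data.Product.Relation.Binary.Pointwise.NonDependent using (_×ₛ_; Pointwise-≡↔≡)
open import Data.Product.Function.NonDependent.Setoid using (_×-inverse_)
open import Function using (_∘_; id; _on_)
open import Function.Bundles using (Inverse; Func; _⟨$⟩_)
open import Function.Definitions using (Congruent; StrictlyInverseˡ; StrictlyInverseʳ)
open import Function.Consequences.Setoid using (strictlyInverseˡ⇒inverseˡ; strictlyInverseʳ⇒inverseʳ)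
open import Function.Construct.Composition using () renaming (inverse to infixr 9 _⨾_)
open import Function.Construct.Symmetry using (↔-sym)
import Function.Relation.Binary.Setoid.Equality as FuncEq
open import Relation.Nullary using (yes; no; ¬_)
open import Data.Empty using (⊥-elim)
open import Relation.Unary using (Pred; Decidable)
open import Relation.Binary.Bundles using (Setoid)
open import Relation.Binary.Definitions using (_Respects_)
import Relation.Binary.Construct.On as On
import Relation.Binary.Reasoning.Setoid as SetoidReasoning
open import Relation.Binary.PropositionalEquality as ≡
  using (_≡_; refl; sym; trans; cong; cong₂; subst; module ≡-Reasoning)

open Setoid using (Carrier)

FinS : ℕ → Setoid 0ℓ 0ℓ
FinS n = ≡.setoid (Fin n)

mkInverse : {S T : Setoid 0ℓ 0ℓ} (to : Carrier S → Carrier T) (from : Carrier T → Carrier S) →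
  Congruent (Setoid._≈_ S) (Setoid._≈_ T) to → Congruent (Setoid._≈_ T) (Setoid._≈_ S) from →
  StrictlyInverseˡ (Setoid._≈_ T) to from → StrictlyInverseʳ (Setoid._≈_ S) to from →
  Inverse S T
mkInverse {S} {T} to from to-cong from-cong invˡ invʳ = record
  { to = to ; from = from ; to-cong = to-cong ; from-cong = from-cong
  ; inverse = strictlyInverseˡ⇒inverseˡ S T to-cong invˡ , strictlyInverseʳ⇒inverseʳ S T from-cong invʳ }

Πₛ : ∀ {r} → (Fin r → Setoid 0ℓ 0ℓ) → Setoid 0ℓ 0ℓ
Πₛ {r} S = record
  { Carrier = (i : Fin r) → Carrier (S i)
  ; _≈_ = λ f g → ∀ i → Setoid._≈_ (S i) (f i) (g i)
  ; isEquivalence = record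
    { refl = λ i → Setoid.refl (S i)
    ; sym = λ p i → Setoid.sym (S i) (p i)
    ; trans = λ p q i → Setoid.trans (S i) (p i) (q i) } }

Subₛ : (S : Setoid 0ℓ 0ℓ) → Pred (Carrier S) 0ℓ → Setoid 0ℓ 0ℓ
Subₛ S P = On.setoid S (proj₁ {B = P})

Π↔× : ∀ {r} (S : Fin (suc r) → Setoid 0ℓ 0ℓ) → Inverse (Πₛ S) (S zero ×ₛ Πₛ (S ∘ suc))
Π↔× S = mkInverse (λ f → f zero , f ∘ suc) cons (λ f≈g → f≈g zero , f≈g ∘ suc)
  (λ { (x≈y , f≈g) → λ { zero → x≈y ; (suc i) → f≈g i } })
  (λ _ → Setoid.refl (S zero) , λ i → Setoid.refl (S (suc i)))
  (λ _ → λ { zero → Setoid.refl (S zero) ; (suc i) → Setoid.refl (S (suc i)) })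
  where
  cons : Carrier (S zero ×ₛ Πₛ (S ∘ suc)) → Carrier (Πₛ S)
  cons (x , f) zero = x
  cons (x , f) (suc i) = f i

HasCard-Π : ∀ {r} (S : Fin r → Setoid 0ℓ 0ℓ) {N : Fin r → ℕ} →
  (∀ i → HasCard (S i) (N i)) → HasCard (Πₛ S) (∏ N)
HasCard-Π {zero} S _ = mkInverse (λ _ → zero) (λ _ ()) (λ _ → refl) (λ _ ()) (λ { zero → refl }) (λ _ ())
HasCard-Π {suc r} S card =
  Π↔× S ⨾ (card zero ×-inverse HasCard-Π (S ∘ suc) (card ∘ suc)) ⨾ Pointwise-≡↔≡ ⨾ ↔-sym *↔×

module _ {m} (P : Pred (Fin (suc m)) 0ℓ) {c} (card : HasCard (Subₛ (FinS m) (P ∘ suc)) c) where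
  private module card = Inverse card

  HasCard-Sub-suc-yes : P zero → HasCard (Subₛ (FinS (suc m)) P) (suc c)
  HasCard-Sub-suc-yes p = mkInverse to from to-cong (λ { refl → refl }) invˡ invʳ
    where
    to : Σ (Fin (suc m)) P → Fin (suc c)
    to (zero , _) = zero
    to (suc k , pk) = suc (card.to (k , pk))
    from : Fin (suc c) → Σ (Fin (suc m)) P
    from zero = zero , p
    from (suc l) = map suc id (card.from l)
    to-cong : Congruent (_≡_ on proj₁) _≡_ to
    to-cong {zero , _} {zero , _} _ = refl
    to-cong {suc _ , _} {suc _ , _} k≡k′ = cong suc (card.to-cong (suc-injective k≡k′))
    invˡ : ∀ l → to (from l) ≡ l
    invˡ zero = refl
    invˡ (suc l) = cong suc (card.strictlyInverseˡ l)
    invʳ : ∀ x → proj₁ (from (to x)) ≡ proj₁ x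
    invʳ (zero , _) = refl
    invʳ (suc k , pk) = cong suc (card.strictlyInverseʳ (k , pk))

  HasCard-Sub-suc-no : ¬ P zero → HasCard (Subₛ (FinS (suc m)) P) c
  HasCard-Sub-suc-no ¬p = mkInverse to from to-cong (λ { refl → refl }) card.strictlyInverseˡ invʳ
    where
    from : Fin c → Σ (Fin (suc m)) P
    from = map suc id ∘ card.from
    to : Σ (Fin (suc m)) P → Fin c
    to (zero , p) = ⊥-elim (¬p p)
    to (suc k , pk) = card.to (k , pk)
    to-cong : Congruent (_≡_ on proj₁) _≡_ to
    to-cong {zero , p} _ = ⊥-elim (¬p p)
    to-cong {suc _ , _} {zero , p} _ = ⊥-elim (¬p p)
    to-cong {suc _ , _} {suc _ , _} k≡k′ = card.to-cong (suc-injective k≡k′)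
    invʳ : ∀ x → proj₁ (from (to x)) ≡ proj₁ x
    invʳ (zero , p) = ⊥-elim (¬p p)
    invʳ (suc k , pk) = cong suc (card.strictlyInverseʳ (k , pk))

HasCard-SubFin : ∀ {m} (P : Pred (Fin m) 0ℓ) → Decidable P → ∃ λ c → HasCard (Subₛ (FinS m) P) c
HasCard-SubFin {zero} P _ =
  0 , mkInverse (λ { (() , _) }) (λ ()) (λ { {() , _} }) (λ { {()} }) (λ ()) (λ { (() , _) })
HasCard-SubFin {suc m} P P? with HasCard-SubFin (P ∘ suc) (P? ∘ suc) | P? zero
... | c , card | yes p = suc c , HasCard-Sub-suc-yes P card p
... | c , card | no ¬p = c , HasCard-Sub-suc-no P card ¬p

HasCard-Sub : ∀ {S m} → HasCard S m → (P : Pred (Carrier S) 0ℓ) →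
  P Respects (Setoid._≈_ S) → Decidable P → ∃ λ c → HasCard (Subₛ S P) c
HasCard-Sub {S} {m} card P resp P? = map₂ (Sub↔SubFin ⨾_) (HasCard-SubFin (P ∘ card.from) (P? ∘ card.from))
  where
  module card = Inverse card
  Sub↔SubFin : Inverse (Subₛ S P) (Subₛ (FinS m) (P ∘ card.from))
  Sub↔SubFin = mkInverse
    (λ (x , px) → card.to x , resp (Setoid.sym S (card.strictlyInverseʳ x)) px)
    (λ (k , pk) → card.from k , pk)
    card.to-cong card.from-cong
    (card.strictlyInverseˡ ∘ proj₁) (card.strictlyInverseʳ ∘ proj₁)

Boundedₛ : ℕ → Setoid 0ℓ 0ℓ
Boundedₛ k = Subₛ (≡.setoid ℕ) (_≤ k)

HasCard-Bounded : ∀ k → HasCard (Boundedₛ k) (suc k)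
HasCard-Bounded k = mkInverse
  (λ (x , x≤k) → fromℕ< (s≤s x≤k)) (λ i → toℕ i , s≤s⁻¹ (toℕ<n i))
  (λ { {x , x≤k} {y , y≤k} x≡y →
       toℕ-injective (trans (toℕ-fromℕ< (s≤s x≤k)) (trans x≡y (sym (toℕ-fromℕ< (s≤s y≤k))))) })
  (cong toℕ) (λ i → fromℕ<-toℕ i _) (λ (x , x≤k) → toℕ-fromℕ< (s≤s x≤k))

module _ {A : Setoid 0ℓ 0ℓ} where
  open Setoid A using (_≈_)

  insertAt-cong : ∀ {n} {xs ys : Fin n → Carrier A} → (∀ k → xs k ≈ ys k) →
    ∀ i {v w} → v ≈ w → ∀ k → insertAt xs i v k ≈ insertAt ys i w k
  insertAt-cong xs≈ys zero v≈w zero = v≈w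
  insertAt-cong xs≈ys zero v≈w (suc k) = xs≈ys k
  insertAt-cong {suc n} xs≈ys (suc i) v≈w zero = xs≈ys zero
  insertAt-cong {suc n} xs≈ys (suc i) v≈w (suc k) = insertAt-cong (xs≈ys ∘ suc) i v≈w k

PointedFuncₛ : (S T : Setoid 0ℓ 0ℓ) → Carrier S → Carrier T → Setoid 0ℓ 0ℓ
PointedFuncₛ S T p q = Subₛ (FuncEq.setoid S T) (λ F → Setoid._≈_ T (F ⟨$⟩ p) q)

module _ {S T : Setoid 0ℓ 0ℓ} {n} (card : HasCard S (suc n)) (p : Carrier S) (q : Carrier T) where
  private
    module card = Inverse card
    module T = Setoid T
    t = card.to p

  -- A pointed map is determined by its values at the n points other than p.
  PointedFunc↔Π : Inverse (PointedFuncₛ S T p q) (Πₛ (λ (_ : Fin n) → T))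
  PointedFunc↔Π = mkInverse to from (λ F≈G → F≈G ∘ card.from ∘ punchIn t)
    (λ g≈h → insertAt-cong {T} g≈h t T.refl ∘ card.to) invˡ invʳ
    where
    to : Carrier (PointedFuncₛ S T p q) → Fin n → Carrier T
    to (F , _) = removeAt ((F ⟨$⟩_) ∘ card.from) t
    from : (Fin n → Carrier T) → Carrier (PointedFuncₛ S T p q)
    from g = record { to = insertAt g t q ∘ card.to
                    ; cong = T.reflexive ∘ cong (insertAt g t q) ∘ card.to-cong }
           , T.reflexive (insertAt-lookup g t q)
    invˡ : ∀ g k → proj₁ (from g) ⟨$⟩ card.from (punchIn t k) T.≈ g k
    invˡ g k = T.reflexive
      (trans (cong (insertAt g t q) (card.strictlyInverseˡ _)) (insertAt-punchIn g t q k))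
    invʳ : ∀ F a → proj₁ (from (to F)) ⟨$⟩ a T.≈ proj₁ F ⟨$⟩ a
    invʳ (F , Fp≈q) a = begin
      insertAt (removeAt h t) t q (card.to a)     ≈⟨ insertAt-cong {T} (λ _ → T.refl) t q≈ht (card.to a) ⟩
      insertAt (removeAt h t) t (h t) (card.to a) ≡⟨ insertAt-removeAt h t (card.to a) ⟩
      F ⟨$⟩ card.from (card.to a)                 ≈⟨ Func.cong F (card.strictlyInverseʳ a) ⟩
      F ⟨$⟩ a                                     ∎
      where
      open SetoidReasoning T
      h : Fin (suc n) → Carrier T
      h = (F ⟨$⟩_) ∘ card.from
      q≈ht : q T.≈ h t
      q≈ht = T.sym (T.trans (Func.cong F (card.strictlyInverseʳ p)) Fp≈q)

∑-cong : ∀ {r} {f g : Vecℕ r} → f ≗ᵥ g → ∑ f ≡ ∑ g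
∑-cong {zero} _ = refl
∑-cong {suc r} f≗g = cong₂ _+_ (f≗g zero) (∑-cong (f≗g ∘ suc))

∑-distrib-+ : ∀ {r} (f g : Vecℕ r) → ∑ (λ i → f i + g i) ≡ ∑ f + ∑ g
∑-distrib-+ {zero} f g = refl
∑-distrib-+ {suc r} f g = trans (cong (f zero + g zero +_) (∑-distrib-+ (f ∘ suc) (g ∘ suc)))
  (interchange (f zero) (g zero) (∑ (f ∘ suc)) (∑ (g ∘ suc)))

∑-mono-≤ : ∀ {r} {f g : Vecℕ r} → f ≤ᵥ g → ∑ f ≤ ∑ g
∑-mono-≤ {zero} _ = z≤n
∑-mono-≤ {suc r} f≤g = +-mono-≤ (f≤g zero) (∑-mono-≤ (f≤g ∘ suc))

∑-zero : ∀ {r} {f : Vecℕ r} → f ≗ᵥ (λ _ → 0) → ∑ f ≡ 0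
∑-zero {zero} _ = refl
∑-zero {suc r} f≗0 = cong₂ _+_ (f≗0 zero) (∑-zero (f≗0 ∘ suc))

term≤∑ : ∀ {r} (f : Vecℕ r) j → f j ≤ ∑ f
term≤∑ f zero = m≤m+n _ _
term≤∑ f (suc j) = ≤-trans (term≤∑ (f ∘ suc) j) (m≤n+m _ _)

∑≡0⇒≗0 : ∀ {r} (f : Vecℕ r) → ∑ f ≡ 0 → f ≗ᵥ (λ _ → 0)
∑≡0⇒≗0 f ∑f≡0 j = n≤0⇒n≡0 (subst (f j ≤_) ∑f≡0 (term≤∑ f j))

∑≡suc⇒nonzero : ∀ {r} (f : Vecℕ r) {n} → ∑ f ≡ suc n → ∃ λ j → 0 < f j
∑≡suc⇒nonzero {suc r} f ∑f≡1+n with f zero in f₀≡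
... | zero = map suc id (∑≡suc⇒nonzero (f ∘ suc) ∑f≡1+n)
... | suc _ = zero , subst (0 <_) (sym f₀≡) (s≤s z≤n)

δ : ∀ {r} → Fin r → Fin r → ℕ
δ zero zero = 1
δ zero (suc _) = 0
δ (suc _) zero = 0
δ (suc i) (suc j) = δ i j

δ-sym : ∀ {r} (i j : Fin r) → δ i j ≡ δ j i
δ-sym zero zero = refl
δ-sym zero (suc j) = refl
δ-sym (suc i) zero = refl
δ-sym (suc i) (suc j) = δ-sym i j

δ≤1 : ∀ {r} (i j : Fin r) → δ i j ≤ 1
δ≤1 zero zero = s≤s z≤n
δ≤1 zero (suc j) = z≤n
δ≤1 (suc i) zero = z≤n
δ≤1 (suc i) (suc j) = δ≤1 i j

δ≤ᵥ : ∀ {r} (x : Vecℕ r) {j} → 0 < x j → δ j ≤ᵥ x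
δ≤ᵥ x {zero} 0<x₀ zero = 0<x₀
δ≤ᵥ x {zero} _ (suc l) = z≤n
δ≤ᵥ x {suc j} _ zero = z≤n
δ≤ᵥ x {suc j} 0<xⱼ (suc l) = δ≤ᵥ (x ∘ suc) 0<xⱼ l

·-cong : ∀ {r} {α β x y : Vecℕ r} → α ≗ᵥ β → x ≗ᵥ y → α · x ≡ β · y
·-cong α≗β x≗y = ∑-cong (λ j → cong₂ _*_ (α≗β j) (x≗y j))

·-distribˡ-+ : ∀ {r} (α x y : Vecℕ r) → α · (λ j → x j + y j) ≡ α · x + α · y
·-distribˡ-+ α x y =
  trans (∑-cong (λ j → *-distribˡ-+ (α j) (x j) (y j))) (∑-distrib-+ (λ j → α j * x j) (λ j → α j * y j))

·-monoʳ-≤ : ∀ {r} (α : Vecℕ r) {x y} → x ≤ᵥ y → α · x ≤ α · y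
·-monoʳ-≤ α x≤y = ∑-mono-≤ (λ j → *-monoʳ-≤ (α j) (x≤y j))

·-zeroʳ : ∀ {r} (α : Vecℕ r) {x} → x ≗ᵥ (λ _ → 0) → α · x ≡ 0
·-zeroʳ α x≗0 = ∑-zero (λ j → trans (cong (α j *_) (x≗0 j)) (*-zeroʳ (α j)))

·-δʳ : ∀ {r} (α : Vecℕ r) j → α · δ j ≡ α j
·-δʳ α zero = trans (cong₂ _+_ (*-identityʳ (α zero)) (·-zeroʳ (α ∘ suc) (λ _ → refl))) (+-identityʳ _)
·-δʳ α (suc j) = trans (cong (_+ (α ∘ suc) · δ j) (*-zeroʳ (α zero))) (·-δʳ (α ∘ suc) j)

·-δˡ : ∀ {r} j (x : Vecℕ r) → δ j · x ≡ x j
·-δˡ j x = trans (∑-cong (λ l → *-comm (δ j l) (x l))) (·-δʳ x j)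

∑-δ : ∀ {r} (j : Fin r) → ∑ (δ j) ≡ 1
∑-δ j = trans (∑-cong (λ l → sym (*-identityˡ (δ j l)))) (·-δʳ (λ _ → 1) j)

E↔ΠBounded : ∀ {r} (u : Vecℕ r) → Inverse (E-setoid u) (Πₛ (Boundedₛ ∘ u))
E↔ΠBounded u = mkInverse (λ (x , x≤u) i → x i , x≤u i) (λ f → proj₁ ∘ f , proj₂ ∘ f)
  id id (λ _ _ → refl) (λ _ _ → refl)

HasCard-E : ∀ {r} (u : Vecℕ r) → HasCard (E-setoid u) (∏ (λ i → suc (u i)))
HasCard-E u = E↔ΠBounded u ⨾ HasCard-Π (Boundedₛ ∘ u) (HasCard-Bounded ∘ u)

Α↔Sub : ∀ {r} (u : Vecℕ r) → (∀ j → 0 < u j) → ∀ i →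
  Inverse (Α-setoid u i) (Subₛ (E-setoid (λ _ → u i)) (λ x → val x · u ≤ u i))
Α↔Sub u u-pos i = mkInverse (λ (α , α·u≤uᵢ) → (α , bounded α·u≤uᵢ) , α·u≤uᵢ) (map val id)
  id id (λ _ _ → refl) (λ _ _ → refl)
  where
  bounded : ∀ {α} → α · u ≤ u i → α ≤ᵥ (λ _ → u i)
  bounded {α} α·u≤uᵢ j =
    ≤-trans (m≤m*n (α j) (u j) {{>-nonZero (u-pos j)}}) (≤-trans (term≤∑ (λ l → α l * u l) j) α·u≤uᵢ)

HasCard-Α : ∀ {r} {u : Vecℕ r} → (∀ j → 0 < u j) → ∀ i → ∃ λ c → HasCard (Α-setoid u i) c
HasCard-Α {u = u} u-pos i = map₂ (Α↔Sub u u-pos i ⨾_)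
  (HasCard-Sub (HasCard-E (λ _ → u i)) (λ x → val x · u ≤ u i)
    (λ x≈y → subst (_≤ u i) (·-cong x≈y λ _ → refl)) (λ x → val x · u ≤? u i))

𝓜↔ΠΑ : ∀ {r} (u : Vecℕ r) → Inverse (𝓜-setoid u) (Πₛ (Α-setoid u))
𝓜↔ΠΑ u = mkInverse (λ (M , Mu≤u) i → M i , Mu≤u i) (λ f → proj₁ ∘ f , proj₂ ∘ f)
  id id (λ _ _ _ → refl) (λ _ _ _ → refl)

module _ {r} {u : Vecℕ r} where

  𝟎 : E u
  𝟎 = (λ _ → 0) , λ _ → z≤n

  Additive : (E u → E u) → Set
  Additive f = ∀ b c (h : val b ⊥[ u ] val c) → val (f (⊕ u b c h)) ≗ᵥ (λ i → val (f b) i + val (f c) i)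

  additive-𝟎 : ∀ {f} → Additive f → val (f 𝟎) ≗ᵥ (λ _ → 0)
  additive-𝟎 {f} f-add i = +-cancelˡ-≡ v v 0 (trans (sym (f-add 𝟎 𝟎 (λ _ → z≤n) i)) (sym (+-identityʳ v)))
    where
    v : ℕ
    v = val (f 𝟎) i

  module _ (u-pos : ∀ i → 0 < u i) where

    e : Fin r → E u
    e j = δ j , λ l → ≤-trans (δ≤1 j l) (u-pos l)

    split-off-unit : (x : E u) {n : ℕ} → ∑ (val x) ≡ suc n →
      ∃₂ λ j y → Σ (val y ⊥[ u ] δ j) λ h → ∑ (val y) ≡ n × x ≈E ⊕ u y (e j) h
    split-off-unit x {n} ∑x≡1+n with ∑≡suc⇒nonzero (val x) ∑x≡1+n
    ... | j , 0<xⱼ = j , y , y⊥eⱼ , ∑y≡n , sym ∘ y+eⱼ≡x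
      where
      y : E u
      y = (λ l → val x l ∸ δ j l) , λ l → ≤-trans (m∸n≤m (val x l) (δ j l)) (proj₂ x l)
      y+eⱼ≡x : ∀ l → val y l + δ j l ≡ val x l
      y+eⱼ≡x l = m∸n+n≡m (δ≤ᵥ (val x) 0<xⱼ l)
      y⊥eⱼ : val y ⊥[ u ] δ j
      y⊥eⱼ l = subst (_≤ u l) (sym (y+eⱼ≡x l)) (proj₂ x l)
      ∑y≡n : ∑ (val y) ≡ n
      ∑y≡n = ℕ.suc-injective (begin
        suc (∑ (val y))           ≡⟨ +-comm 1 _ ⟩
        ∑ (val y) + 1             ≡⟨ cong (∑ (val y) +_) (∑-δ j) ⟨
        ∑ (val y) + ∑ (δ j)       ≡⟨ ∑-distrib-+ (val y) (δ j) ⟨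
        ∑ (λ l → val y l + δ j l) ≡⟨ ∑-cong y+eⱼ≡x ⟩
        ∑ (val x)                 ≡⟨ ∑x≡1+n ⟩
        suc n                     ∎)
        where open ≡-Reasoning

    columns : (E u → E u) → Matℕ r
    columns f i j = val (f (e j)) i

    additive⇒linear : ∀ f → Congruent _≈E_ _≈E_ f → Additive f → ∀ x → val (f x) ≗ᵥ (columns f ⊛ val x)
    additive⇒linear f f-cong f-add x = linear-by-size (∑ (val x)) x refl
      where
      linear-by-size : ∀ n x → ∑ (val x) ≡ n → val (f x) ≗ᵥ (columns f ⊛ val x)
      linear-by-size zero x ∑x≡0 i = begin
        val (f x) i           ≡⟨ f-cong {x} {𝟎} (∑≡0⇒≗0 (val x) ∑x≡0) i ⟩
        val (f 𝟎) i           ≡⟨ additive-𝟎 {f} f-add i ⟩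
        0                     ≡⟨ ·-zeroʳ (columns f i) (∑≡0⇒≗0 (val x) ∑x≡0) ⟨
        columns f i · val x   ∎
        where open ≡-Reasoning
      linear-by-size (suc n) x ∑x≡1+n i with split-off-unit x ∑x≡1+n
      ... | j , y , h , ∑y≡n , x≈y⊕eⱼ = begin
        val (f x) i                             ≡⟨ f-cong x≈y⊕eⱼ i ⟩
        val (f (⊕ u y (e j) h)) i               ≡⟨ f-add y (e j) h i ⟩
        val (f y) i + val (f (e j)) i           ≡⟨ cong₂ _+_ (linear-by-size n y ∑y≡n i) (sym (·-δʳ (columns f i) j)) ⟩
        columns f i · val y + columns f i · δ j ≡⟨ ·-distribˡ-+ (columns f i) (val y) (δ j) ⟨
        columns f i · val (⊕ u y (e j) h)       ≡⟨ ·-cong {α = columns f i} (λ _ → refl) x≈y⊕eⱼ ⟨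
        columns f i · val x                     ∎
        where open ≡-Reasoning

    matrixOf : ∀ f → Congruent _≈E_ _≈E_ f → Additive f → Carrier (𝓜-setoid u)
    matrixOf f f-cong f-add =
      columns f , λ i → subst (_≤ u i) (additive⇒linear f f-cong f-add (top u) i) (proj₂ (f (top u)) i)

  _⊛ₑ_ : Carrier (𝓜-setoid u) → E u → E u
  (M , Mu≤u) ⊛ₑ x = M ⊛ val x , λ i → ≤-trans (·-monoʳ-≤ (M i) (proj₂ x)) (Mu≤u i)

  𝐈 : Carrier (𝓜-setoid u)
  𝐈 = δ , λ i → ≤-reflexive (·-δˡ i u)

  S1⇒additive : ∀ o → S1 u o → ∀ a → Additive (o a)
  S1⇒additive o s1 a b c h = proj₂ (s1 a b c h)

  additive⇒S1 : ∀ o → (∀ a → Additive (o a)) → S1 u o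
  additive⇒S1 o o-add a b c h =
    (λ i → subst (_≤ u i) (o-add a b c h i) (proj₂ (o a (⊕ u b c h)) i)) , o-add a b c h

  Ops↔PointedFunc : (∀ i → 0 < u i) →
    Inverse (Ops-setoid u) (PointedFuncₛ (E-setoid u) (𝓜-setoid u) (top u) 𝐈)
  Ops↔PointedFunc u-pos = mkInverse to from (λ o≈o′ a i j → o≈o′ a (e u-pos j) i)
    (λ F≈G a x i → ·-cong (F≈G a i) (λ _ → refl))
    (λ (F , _) a i j → ·-δʳ (proj₁ (F ⟨$⟩ a) i) j)
    (λ (o , o-cong , s1 , _) a x i →
      sym (additive⇒linear u-pos (o a) (o-cong (λ _ → refl)) (S1⇒additive o s1 a) x i))
    where
    to : Carrier (Ops-setoid u) → Carrier (PointedFuncₛ (E-setoid u) (𝓜-setoid u) (top u) 𝐈)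
    to (o , o-cong , s1 , s2) =
      record { to = λ a → matrixOf u-pos (o a) (o-cong (λ _ → refl)) (S1⇒additive o s1 a)
             ; cong = λ a≈b i j → o-cong a≈b (λ _ → refl) i }
      , λ i j → trans (s2 (e u-pos j) i) (δ-sym j i)
    from : Carrier (PointedFuncₛ (E-setoid u) (𝓜-setoid u) (top u) 𝐈) → Carrier (Ops-setoid u)
    from (F , F⊤≈𝐈) = o
      , (λ a≈b x≈y i → ·-cong (Func.cong F a≈b i) x≈y)
      , additive⇒S1 o (λ a b c h i → ·-distribˡ-+ (proj₁ (F ⟨$⟩ a) i) (val b) (val c))
      , λ x i → trans (·-cong (F⊤≈𝐈 i) (λ _ → refl)) (·-δˡ i (val x))
      where
      o : E u → E u → E u
      o a x = (F ⟨$⟩ a) ⊛ₑ x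

∏-const : ∀ n c → ∏ {n} (λ _ → c) ≡ c ^ n
∏-const zero c = refl
∏-const (suc n) c = cong (c *_) (∏-const n c)

suc[m∸1]≡m : ∀ {m} → Fin m → suc (m ∸ 1) ≡ m
suc[m∸1]≡m {suc m} _ = refl

corollary5p5 : (r : ℕ) (u : Fin r → ℕ) → (∀ i → 0 < u i) →
    Σ (Fin r → ℕ) λ N →
      ((i : Fin r) → HasCard (Α-setoid u i) (N i))
      × HasCard (𝓜-setoid u) (∏ N)
      × HasCard (E-setoid u) (∏ (λ i → suc (u i)))
      × HasCard (Ops-setoid u) (∏ N ^ (∏ (λ i → suc (u i)) ∸ 1))
corollary5p5 r u u-pos = N , Α-card , 𝓜-card , HasCard-E u , Ops-card
  where
  N : Fin r → ℕ
  N i = proj₁ (HasCard-Α u-pos i)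
  Α-card : ∀ i → HasCard (Α-setoid u i) (N i)
  Α-card i = proj₂ (HasCard-Α u-pos i)
  𝓜-card : HasCard (𝓜-setoid u) (∏ N)
  𝓜-card = 𝓜↔ΠΑ u ⨾ HasCard-Π (Α-setoid u) Α-card
  n : ℕ
  n = ∏ (λ i → suc (u i)) ∸ 1
  E-card : HasCard (E-setoid u) (suc n)
  E-card = subst (HasCard (E-setoid u)) (sym (suc[m∸1]≡m (Inverse.to (HasCard-E u) (top u))))
    (HasCard-E u)
  Ops-card : HasCard (Ops-setoid u) (∏ N ^ n)
  Ops-card = subst (HasCard (Ops-setoid u)) (∏-const n (∏ N))
    (Ops↔PointedFunc u-pos ⨾ PointedFunc↔Π E-card (top u) 𝐈 ⨾ HasCard-Π (λ _ → 𝓜-setoid u) (λ _ → 𝓜-card))
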